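{- Let $p_1,q_1,p_2,q_2$ be non-negative integers with $p_1>0$, $q_2>0$ and $\det Q:=p_1q_2-q_1p_2>0$, and let $\mathcal{M}\subseteq \mathcal{B}'$. Let $G_Q=G_Q(\mathcal{M})$ be the $Q$-subtraction game and $G=G(\mathcal{M})$ the subtraction game (defined in the context). Suppose $(X,Y)\in\mathcal{B}_Q$. Then $(X,Y)\in\mathcal{P}(G_Q)$ if and only if $\varphi_Q(X,Y)\in\mathcal{P}(G)$, where $$\varphi_Q(X,Y)=\left(\left\lfloor \frac{Xq_2-Yp_2}{\det Q}\right\rfloor,\left\lfloor\frac{Yp_1-Xq_1}{\det Q}\right\rfloor\right).$$ Equivalently: for $(A,B)\in\mathcal{B}$, $(A,B)\in\mathcal{P}(G)$ if and only if, for all $(x,y)\in\mathcal{T}_Q$, $(x+Ap_1+Bp_2,\ y+Aq_1+Bq_2)\in\mathcal{P}(G_Q)$.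
   Context: All games are impartial two-player games under normal play (a player who cannot move loses). A position is in $\mathcal{P}(G)$ (previous-player win) if none of its options is in $\mathcal{P}(G)$, and otherwise in $\mathcal{N}(G)$; terminal positions (no moves) are in $\mathcal{P}$. Let $\mathcal{B}$ be the set of ordered pairs of non-negative integers and $\mathcal{B}'=\mathcal{B}\setminus\{(0,0)\}$. Let $\mathcal{B}_Q=\{(X,Y)\in\mathcal{B}\mid Xq_1\le Yp_1 \text{ and } Yp_2\le Xq_2\}$. The subtraction game $G(\mathcal{M})$ has positions $\mathcal{B}$, and a move from $(A,B)$ to $(A-s,B-t)$ for any $(s,t)\in\mathcal{M}$ with $(A-s,B-t)\in\mathcal{B}$. The $Q$-subtraction game $G_Q(\mathcal{M})$ has positions $\mathcal{B}_Q$, and a move from $(X,Y)$ to $(X-p_1s-p_2t,\ Y-q_1s-q_2t)$ for any $(s,t)\in\mathcal{M}$ such that this pair lies in $\mathcal{B}_Q$. Let $\mathcal{T}_Q=\{(x,y)\in\mathcal{B}_Q\mid p_1(y-q_2)<q_1(x-p_2)\text{ and } p_2(y-q_1)>q_2(x-p_1)\}$. -}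

module Defs where

open import Data.Nat.Base
open import Data.Nat.Properties using (m<n⇒0<n∸m)
open import Data.Product using (_×_; _,_)
open import Data.Unit using (⊤)
open import Relation.Nullary using (¬_)

MoveSet : Set₁
MoveSet = ℕ → ℕ → Set

InBQ : (p₁ q₁ p₂ q₂ : ℕ) → ℕ → ℕ → Set
InBQ p₁ q₁ p₂ q₂ X Y = (X * q₁ ≤ Y * p₁) × (Y * p₂ ≤ X * q₂)

-- The integer inequalities
--   p₁(y−q₂) < q₁(x−p₂)   and   p₂(y−q₁) > q₂(x−p₁)
-- are rewritten (by moving the negative terms across) as inequalities in ℕ:
--   p₁ y + q₁ p₂ < q₁ x + p₁ q₂   and   q₂ x + p₂ q₁ < p₂ y + q₂ p₁.
InTQ : (p₁ q₁ p₂ q₂ : ℕ) → ℕ → ℕ → Set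
InTQ p₁ q₁ p₂ q₂ x y =
  InBQ p₁ q₁ p₂ q₂ x y
  × (p₁ * y + q₁ * p₂ < q₁ * x + p₁ * q₂)
  × (q₂ * x + p₂ * q₁ < p₂ * y + q₂ * p₁)

-- For M ⊆ ℬ' each move decreases A + B by at least 1, so fuel A + B suffices.
Pf : MoveSet → ℕ → ℕ → ℕ → Set
Pf M zero    A B = ⊤
Pf M (suc k) A B =
  ∀ s t → M s t → s ≤ A → t ≤ B → ¬ Pf M k (A ∸ s) (B ∸ t)

IsP : MoveSet → ℕ → ℕ → Set
IsP M A B = Pf M (A + B) A B

-- Under p₁ > 0, q₂ > 0 and M ⊆ ℬ', each move decreases X + Y by ≥ 1.
PQf : (p₁ q₁ p₂ q₂ : ℕ) → MoveSet → ℕ → ℕ → ℕ → Set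
PQf p₁ q₁ p₂ q₂ M zero    X Y = ⊤
PQf p₁ q₁ p₂ q₂ M (suc k) X Y =
  ∀ s t → M s t →
  (le₁ : p₁ * s + p₂ * t ≤ X) → (le₂ : q₁ * s + q₂ * t ≤ Y) →
  InBQ p₁ q₁ p₂ q₂ (X ∸ (p₁ * s + p₂ * t)) (Y ∸ (q₁ * s + q₂ * t)) →
  ¬ PQf p₁ q₁ p₂ q₂ M k (X ∸ (p₁ * s + p₂ * t)) (Y ∸ (q₁ * s + q₂ * t))

IsPQ : (p₁ q₁ p₂ q₂ : ℕ) → MoveSet → ℕ → ℕ → Set
IsPQ p₁ q₁ p₂ q₂ M X Y = PQf p₁ q₁ p₂ q₂ M (X + Y) X Y

-- det Q = p₁ q₂ − q₁ p₂ (used only when q₁ p₂ < p₁ q₂)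
detQ : (p₁ q₁ p₂ q₂ : ℕ) → ℕ
detQ p₁ q₁ p₂ q₂ = p₁ * q₂ ∸ q₁ * p₂

detQ-nonZero : ∀ {p₁ q₁ p₂ q₂} → q₁ * p₂ < p₁ * q₂ → NonZero (detQ p₁ q₁ p₂ q₂)
detQ-nonZero d = >-nonZero (m<n⇒0<n∸m d)

-- φ_Q(X,Y) = (⌊(X q₂ − Y p₂)/det Q⌋, ⌊(Y p₁ − X q₁)/det Q⌋).
-- On ℬ_Q both numerators are non-negative, so truncated subtraction is exact.
φQ : (p₁ q₁ p₂ q₂ : ℕ) → q₁ * p₂ < p₁ * q₂ → ℕ → ℕ → ℕ × ℕ
φQ p₁ q₁ p₂ q₂ d X Y =
  ((X * q₂ ∸ Y * p₂) / detQ p₁ q₁ p₂ q₂ , (Y * p₁ ∸ X * q₁) / detQ p₁ q₁ p₂ q₂)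
  where instance _ = detQ-nonZero {p₁} {q₁} {p₂} {q₂} d

-- In adjugate coordinates (u , v) = adj Q (X , Y), i.e. det Q · (X , Y) = Q (u , v), the
-- region ℬ_Q becomes ℕ² and the G_Q-move by (s , t) becomes subtraction of
-- (s · det Q , t · det Q).  So this move is legal at (X , Y) exactly when (s , t) is a legal
-- G-move at φ_Q (X , Y) = ⌊(u , v) / det Q⌋, and it leads to a position with image
-- φ_Q (X , Y) − (s , t); induction on positions then matches the P-positions of both games.
-- For the second part, the inequalities defining 𝒯_Q say that adj Q (x , y) < (det Q , det Q)
-- componentwise, so φ_Q (x + Q (A , B)) = (A , B) on 𝒯_Q, and (0 , 0) ∈ 𝒯_Q.
module Submission where

open import Defs
open import Data.Nat.Base
open import Data.Nat.Properties
open import Data.Nat.DivMod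
open import Data.Nat.Divisibility using (divides)
open import Data.Nat.Tactic.RingSolver using (solve)
open import Data.List.Base using (_∷_; [])
open import Data.Product using (_×_; _,_; proj₁; proj₂)
open import Relation.Binary.PropositionalEquality
open import Relation.Nullary using (¬_)
open import Data.Empty using (⊥-elim)
open import Data.Unit using (tt)
open import Function.Bundles using (_⇔_; mk⇔; Equivalence)

[m+kn]/n≡m/n+k : ∀ m k n .{{_ : NonZero n}} → (m + k * n) / n ≡ m / n + k
[m+kn]/n≡m/n+k m k n =
  trans (+-distrib-/-∣ʳ m (divides k refl)) (cong (m / n +_) (m*n/n≡m k n))

-- Cramer's rule for the 2×2 matrix (a c; b e) of determinant D, read in both directions,
-- with every term moved so that no subtraction occurs.
cramer : ∀ {a b c e D X Y u v} .{{_ : NonZero D}} → D + b * c ≡ a * e →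
         X * D ≡ a * u + c * v → Y * D ≡ b * u + e * v → X * e ≡ Y * c + u
cramer {a} {b} {c} {e} {D} {X} {Y} {u} {v} det hX hY = *-cancelʳ-≡ _ _ D (begin
  X * e * D                     ≡⟨ solve (X ∷ e ∷ D ∷ []) ⟩
  X * D * e                     ≡⟨ cong (_* e) hX ⟩
  (a * u + c * v) * e           ≡⟨ solve (a ∷ u ∷ c ∷ v ∷ e ∷ []) ⟩
  a * e * u + c * (e * v)       ≡⟨ cong (λ z → z * u + c * (e * v)) (sym det) ⟩
  (D + b * c) * u + c * (e * v) ≡⟨ solve (D ∷ b ∷ c ∷ u ∷ e ∷ v ∷ []) ⟩
  c * (b * u + e * v) + u * D   ≡⟨ cong (λ z → c * z + u * D) (sym hY) ⟩
  c * (Y * D) + u * D           ≡⟨ solve (c ∷ Y ∷ D ∷ u ∷ []) ⟩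
  (Y * c + u) * D               ∎)
  where open ≡-Reasoning

cramer⁻¹ : ∀ {a b c e D X Y u v} → D + b * c ≡ a * e →
           X * e ≡ Y * c + u → Y * a ≡ X * b + v → X * D ≡ a * u + c * v
cramer⁻¹ {a} {b} {c} {e} {D} {X} {Y} {u} {v} det hX hY =
  +-cancelʳ-≡ (X * b * c) _ _ (begin
  X * D + X * b * c       ≡⟨ solve (X ∷ D ∷ b ∷ c ∷ []) ⟩
  X * (D + b * c)         ≡⟨ cong (X *_) det ⟩
  X * (a * e)             ≡⟨ solve (X ∷ a ∷ e ∷ []) ⟩
  a * (X * e)             ≡⟨ cong (a *_) hX ⟩
  a * (Y * c + u)         ≡⟨ solve (a ∷ Y ∷ c ∷ u ∷ []) ⟩
  a * u + c * (Y * a)     ≡⟨ cong (λ z → a * u + c * z) hY ⟩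
  a * u + c * (X * b + v) ≡⟨ solve (a ∷ u ∷ c ∷ X ∷ b ∷ v ∷ []) ⟩
  a * u + c * v + X * b * c ∎)
  where open ≡-Reasoning

linear-shift : ∀ a b u v s t D →
               a * (u + s * D) + b * (v + t * D) ≡ (a * u + b * v) + (a * s + b * t) * D
linear-shift a b u v s t D = solve (a ∷ b ∷ u ∷ v ∷ s ∷ t ∷ D ∷ [])

*-∸-split : ∀ {X w k D} .{{_ : NonZero D}} → X * D ≡ w + k * D → k ≤ X × (X ∸ k) * D ≡ w
*-∸-split {X} {w} {k} {D} h =
    *-cancelʳ-≤ k X D (subst (k * D ≤_) (sym h) (m≤n+m (k * D) w))
  , (begin
      (X ∸ k) * D       ≡⟨ *-distribʳ-∸ D X k ⟩
      X * D ∸ k * D     ≡⟨ cong (_∸ k * D) h ⟩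
      w + k * D ∸ k * D ≡⟨ m+n∸n≡m w (k * D) ⟩
      w                 ∎)
  where open ≡-Reasoning

remainder<det : ∀ {a b c e D X Y u} → D + b * c ≡ a * e → X * e ≡ Y * c + u →
             e * X + c * b < c * Y + e * a → u < D
remainder<det {a} {b} {c} {e} {D} {X} {Y} {u} det bal lt =
  +-cancelʳ-< (Y * c + b * c) u D (subst₂ _<_ lhs rhs lt)
  where
  open ≡-Reasoning
  lhs : e * X + c * b ≡ u + (Y * c + b * c)
  lhs = begin
    e * X + c * b       ≡⟨ solve (e ∷ X ∷ c ∷ b ∷ []) ⟩
    X * e + b * c       ≡⟨ cong (_+ b * c) bal ⟩
    Y * c + u + b * c   ≡⟨ solve (Y ∷ c ∷ u ∷ b ∷ []) ⟩
    u + (Y * c + b * c) ∎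
  rhs : c * Y + e * a ≡ D + (Y * c + b * c)
  rhs = begin
    c * Y + e * a       ≡⟨ solve (c ∷ Y ∷ e ∷ a ∷ []) ⟩
    Y * c + a * e       ≡⟨ cong (Y * c +_) (sym det) ⟩
    Y * c + (D + b * c) ≡⟨ solve (Y ∷ c ∷ D ∷ b ∷ []) ⟩
    D + (Y * c + b * c) ∎

descent : ∀ a b s t {a₀ b₀ n} → 0 < s + t → a + s ≡ a₀ → b + t ≡ b₀ → a₀ + b₀ ≤ n → a + b < n
descent a b s t {a₀} {b₀} {n} pos ea eb le = begin-strict
  a + b             <⟨ m<m+n (a + b) pos ⟩
  a + b + (s + t)   ≡⟨ solve (a ∷ b ∷ s ∷ t ∷ []) ⟩
  (a + s) + (b + t) ≡⟨ cong₂ _+_ ea eb ⟩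
  a₀ + b₀           ≤⟨ le ⟩
  n                 ∎
  where open ≤-Reasoning

module Adjugate (p₁ q₁ p₂ q₂ : ℕ) (d : q₁ * p₂ < p₁ * q₂) where

  D : ℕ
  D = detQ p₁ q₁ p₂ q₂

  instance
    D≢0 : NonZero D
    D≢0 = detQ-nonZero {p₁} {q₁} {p₂} {q₂} d

  D+q₁p₂≡p₁q₂ : D + q₁ * p₂ ≡ p₁ * q₂
  D+q₁p₂≡p₁q₂ = m∸n+n≡m (<⇒≤ d)

  D+p₂q₁≡q₂p₁ : D + p₂ * q₁ ≡ q₂ * p₁
  D+p₂q₁≡q₂p₁ = trans (cong (D +_) (*-comm p₂ q₁)) (trans D+q₁p₂≡p₁q₂ (*-comm p₁ q₂))

  Q₁ Q₂ : ℕ → ℕ → ℕ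
  Q₁ s t = p₁ * s + p₂ * t
  Q₂ s t = q₁ * s + q₂ * t

  adj₁ adj₂ : ℕ → ℕ → ℕ
  adj₁ X Y = X * q₂ ∸ Y * p₂
  adj₂ X Y = Y * p₁ ∸ X * q₁

  φ₁ φ₂ : ℕ → ℕ → ℕ
  φ₁ X Y = adj₁ X Y / D
  φ₂ X Y = adj₂ X Y / D

  -- (u , v) = adj Q (X , Y), in the division-free form det Q · (X , Y) = Q (u , v).
  record AdjCoords (X Y u v : ℕ) : Set where
    constructor adjCoords
    field
      X*D≡Q₁ : X * D ≡ Q₁ u v
      Y*D≡Q₂ : Y * D ≡ Q₂ u v

  AdjCoords⇒balance : ∀ {X Y u v} → AdjCoords X Y u v →
                      X * q₂ ≡ Y * p₂ + u × Y * p₁ ≡ X * q₁ + v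
  AdjCoords⇒balance {X} {Y} {u} {v} (adjCoords hX hY) =
      cramer {p₁} {q₁} {p₂} {q₂} {D} {X} {Y} {u} {v} D+q₁p₂≡p₁q₂ hX hY
    , cramer {q₂} {p₂} {q₁} {p₁} {D} {Y} {X} {v} {u} D+p₂q₁≡q₂p₁
        (trans hY (+-comm (q₁ * u) _)) (trans hX (+-comm (p₁ * u) _))

  balance⇒AdjCoords : ∀ {X Y u v} → X * q₂ ≡ Y * p₂ + u → Y * p₁ ≡ X * q₁ + v →
                      AdjCoords X Y u v
  balance⇒AdjCoords {X} {Y} {u} {v} hX hY = adjCoords
    (cramer⁻¹ {p₁} {q₁} {p₂} {q₂} {D} {X} {Y} {u} {v} D+q₁p₂≡p₁q₂ hX hY)
    (trans (cramer⁻¹ {q₂} {p₂} {q₁} {p₁} {D} {Y} {X} {v} {u} D+p₂q₁≡q₂p₁ hY hX)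
           (+-comm (q₂ * v) _))

  AdjCoords⇒InBQ : ∀ {X Y u v} → AdjCoords X Y u v → InBQ p₁ q₁ p₂ q₂ X Y
  AdjCoords⇒InBQ {X} {Y} c =
    let hX , hY = AdjCoords⇒balance c
    in subst (X * q₁ ≤_) (sym hY) (m≤m+n _ _) , subst (Y * p₂ ≤_) (sym hX) (m≤m+n _ _)

  AdjCoords⇒adj : ∀ {X Y u v} → AdjCoords X Y u v → adj₁ X Y ≡ u × adj₂ X Y ≡ v
  AdjCoords⇒adj {X} {Y} {u} {v} c =
    let hX , hY = AdjCoords⇒balance c
    in trans (cong (_∸ Y * p₂) hX) (m+n∸m≡n (Y * p₂) u)
     , trans (cong (_∸ X * q₁) hY) (m+n∸m≡n (X * q₁) v)

  InBQ⇒AdjCoords : ∀ {X Y} → InBQ p₁ q₁ p₂ q₂ X Y → AdjCoords X Y (adj₁ X Y) (adj₂ X Y)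
  InBQ⇒AdjCoords (Xq₁≤Yp₁ , Yp₂≤Xq₂) =
    balance⇒AdjCoords (sym (m+[n∸m]≡n Yp₂≤Xq₂)) (sym (m+[n∸m]≡n Xq₁≤Yp₁))

  AdjCoords-+ : ∀ {X Y u v} s t → AdjCoords X Y u v →
                AdjCoords (X + Q₁ s t) (Y + Q₂ s t) (u + s * D) (v + t * D)
  AdjCoords-+ {X} {Y} {u} {v} s t (adjCoords hX hY) = adjCoords
    (trans (*-distribʳ-+ D X (Q₁ s t))
           (trans (cong (_+ Q₁ s t * D) hX) (sym (linear-shift p₁ p₂ u v s t D))))
    (trans (*-distribʳ-+ D Y (Q₂ s t))
           (trans (cong (_+ Q₂ s t * D) hY) (sym (linear-shift q₁ q₂ u v s t D))))

  record LegalMove (X Y s t : ℕ) : Set where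
    constructor legalMove
    field
      Q₁≤X : Q₁ s t ≤ X
      Q₂≤Y : Q₂ s t ≤ Y
      after∈BQ : InBQ p₁ q₁ p₂ q₂ (X ∸ Q₁ s t) (Y ∸ Q₂ s t)

  AdjCoords-∸ : ∀ {X Y u v} s t → AdjCoords X Y (u + s * D) (v + t * D) →
                LegalMove X Y s t
  AdjCoords-∸ {X} {Y} {u} {v} s t (adjCoords hX hY) =
    let le₁ , hX' = *-∸-split {D = D} (trans hX (linear-shift p₁ p₂ u v s t D))
        le₂ , hY' = *-∸-split {D = D} (trans hY (linear-shift q₁ q₂ u v s t D))
    in legalMove le₁ le₂ (AdjCoords⇒InBQ {X ∸ Q₁ s t} {Y ∸ Q₂ s t} (adjCoords hX' hY'))

  legal⇒φ-shift : ∀ {X Y s t} → LegalMove X Y s t →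
                  φ₁ X Y ≡ φ₁ (X ∸ Q₁ s t) (Y ∸ Q₂ s t) + s
                × φ₂ X Y ≡ φ₂ (X ∸ Q₁ s t) (Y ∸ Q₂ s t) + t
  legal⇒φ-shift {X} {Y} {s} {t} (legalMove le₁ le₂ after) =
    trans (cong (_/ D) (proj₁ adj-shift)) ([m+kn]/n≡m/n+k _ s D) ,
    trans (cong (_/ D) (proj₂ adj-shift)) ([m+kn]/n≡m/n+k _ t D)
    where
    X' = X ∸ Q₁ s t
    Y' = Y ∸ Q₂ s t
    adj-shift : adj₁ X Y ≡ adj₁ X' Y' + s * D × adj₂ X Y ≡ adj₂ X' Y' + t * D
    adj-shift = AdjCoords⇒adj
      (subst₂ (λ x y → AdjCoords x y (adj₁ X' Y' + s * D) (adj₂ X' Y' + t * D))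
              (m∸n+n≡m le₁) (m∸n+n≡m le₂)
              (AdjCoords-+ s t (InBQ⇒AdjCoords {X'} {Y'} after)))

  legal⇒φ-bounded : ∀ {X Y s t} → LegalMove X Y s t → s ≤ φ₁ X Y × t ≤ φ₂ X Y
  legal⇒φ-bounded {s = s} {t} mv =
    let e₁ , e₂ = legal⇒φ-shift mv
    in subst (s ≤_) (sym e₁) (m≤n+m s _) , subst (t ≤_) (sym e₂) (m≤n+m t _)

  legal⇒φ-after : ∀ {X Y s t} → LegalMove X Y s t →
                  φ₁ X Y ∸ s ≡ φ₁ (X ∸ Q₁ s t) (Y ∸ Q₂ s t)
                × φ₂ X Y ∸ t ≡ φ₂ (X ∸ Q₁ s t) (Y ∸ Q₂ s t)
  legal⇒φ-after {s = s} {t} mv =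
    let e₁ , e₂ = legal⇒φ-shift mv
    in trans (cong (_∸ s) e₁) (m+n∸n≡m _ s) , trans (cong (_∸ t) e₂) (m+n∸n≡m _ t)


  φ-bounded⇒legal : ∀ {X Y s t} → InBQ p₁ q₁ p₂ q₂ X Y → s ≤ φ₁ X Y → t ≤ φ₂ X Y →
                    LegalMove X Y s t
  φ-bounded⇒legal {X} {Y} {s} {t} inBQ s≤φ₁ t≤φ₂ =
    AdjCoords-∸ s t (subst₂ (AdjCoords X Y) (sym (m∸n+n≡m sD≤u)) (sym (m∸n+n≡m tD≤v))
                            (InBQ⇒AdjCoords {X} {Y} inBQ))
    where
    sD≤u : s * D ≤ adj₁ X Y
    sD≤u = ≤-trans (*-monoˡ-≤ D s≤φ₁) (m/n*n≤m (adj₁ X Y) D)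
    tD≤v : t * D ≤ adj₂ X Y
    tD≤v = ≤-trans (*-monoˡ-≤ D t≤φ₂) (m/n*n≤m (adj₂ X Y) D)

  InTQ⇒adj<D : ∀ {x y} → InTQ p₁ q₁ p₂ q₂ x y → adj₁ x y < D × adj₂ x y < D
  InTQ⇒adj<D {x} {y} (inBQ , lt₁ , lt₂) =
    let bal₁ , bal₂ = AdjCoords⇒balance (InBQ⇒AdjCoords {x} {y} inBQ)
    in remainder<det {p₁} {q₁} {p₂} {q₂} D+q₁p₂≡p₁q₂ bal₁ lt₂
     , remainder<det {q₂} {p₂} {q₁} {p₁} D+p₂q₁≡q₂p₁ bal₂ lt₁

  InTQ-origin : InTQ p₁ q₁ p₂ q₂ 0 0
  InTQ-origin = (z≤n , z≤n) , lt₁ , lt₂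
    where
    lt₁ : p₁ * 0 + q₁ * p₂ < q₁ * 0 + p₁ * q₂
    lt₁ rewrite *-zeroʳ p₁ | *-zeroʳ q₁ = d
    lt₂ : q₂ * 0 + p₂ * q₁ < p₂ * 0 + q₂ * p₁
    lt₂ rewrite *-zeroʳ q₂ | *-zeroʳ p₂ | *-comm p₂ q₁ | *-comm q₂ p₁ = d

  InTQ-translate : ∀ {x y} A B → InTQ p₁ q₁ p₂ q₂ x y →
                   InBQ p₁ q₁ p₂ q₂ (x + A * p₁ + B * p₂) (y + A * q₁ + B * q₂)
                 × φ₁ (x + A * p₁ + B * p₂) (y + A * q₁ + B * q₂) ≡ A
                 × φ₂ (x + A * p₁ + B * p₂) (y + A * q₁ + B * q₂) ≡ B
  InTQ-translate {x} {y} A B inTQ@(inBQ , _) =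
      AdjCoords⇒InBQ translated
    , floor (proj₁ (AdjCoords⇒adj translated)) (proj₁ (InTQ⇒adj<D inTQ))
    , floor (proj₂ (AdjCoords⇒adj translated)) (proj₂ (InTQ⇒adj<D inTQ))
    where
    reorder : ∀ z a b → z + (a * A + b * B) ≡ z + A * a + B * b
    reorder z a b = solve (z ∷ a ∷ A ∷ b ∷ B ∷ [])
    translated : AdjCoords (x + A * p₁ + B * p₂) (y + A * q₁ + B * q₂)
                           (adj₁ x y + A * D) (adj₂ x y + B * D)
    translated = subst₂ (λ X Y → AdjCoords X Y (adj₁ x y + A * D) (adj₂ x y + B * D))
                        (reorder x p₁ p₂) (reorder y q₁ q₂)
                        (AdjCoords-+ A B (InBQ⇒AdjCoords {x} {y} inBQ))
    floor : ∀ {w r k} → w ≡ r + k * D → r < D → w / D ≡ k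
    floor {w} {r} {k} w≡ r<D = begin
      w / D           ≡⟨ cong (_/ D) w≡ ⟩
      (r + k * D) / D ≡⟨ [m+kn]/n≡m/n+k r k D ⟩
      r / D + k       ≡⟨ cong (_+ k) (m<n⇒m/n≡0 r<D) ⟩
      k               ∎
      where open ≡-Reasoning

module Correspondence (p₁ q₁ p₂ q₂ : ℕ) (p₁>0 : 0 < p₁) (q₂>0 : 0 < q₂) (d : q₁ * p₂ < p₁ * q₂)
                      (M : MoveSet) (M⊆B' : ∀ s t → M s t → ¬ (s ≡ 0 × t ≡ 0)) where

  open Adjugate p₁ q₁ p₂ q₂ d

  move-pos : ∀ s t → M s t → 0 < s + t
  move-pos zero    zero    m = ⊥-elim (M⊆B' 0 0 m (refl , refl))
  move-pos zero    (suc t) _ = z<s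
  move-pos (suc s) t       _ = z<s

  Q-move-pos : ∀ s t → M s t → 0 < Q₁ s t + Q₂ s t
  Q-move-pos zero    zero    m = ⊥-elim (M⊆B' 0 0 m (refl , refl))
  Q-move-pos (suc s) t       _ =
    ≤-trans p₁>0 (≤-trans (m≤m*n p₁ (suc s)) (≤-trans (m≤m+n _ (p₂ * t)) (m≤m+n _ _)))
  Q-move-pos zero    (suc t) _ =
    ≤-trans q₂>0 (≤-trans (m≤m*n q₂ (suc t)) (≤-trans (m≤n+m _ (q₁ * 0)) (m≤n+m _ (Q₁ 0 (suc t)))))

  Q-descent : ∀ {X Y s t n} → M s t → LegalMove X Y s t → X + Y ≤ n →
              (X ∸ Q₁ s t) + (Y ∸ Q₂ s t) < n
  Q-descent {X} {Y} {s} {t} Ms (legalMove le₁ le₂ _) =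
    descent (X ∸ Q₁ s t) (Y ∸ Q₂ s t) (Q₁ s t) (Q₂ s t)
            (Q-move-pos s t Ms) (m∸n+n≡m le₁) (m∸n+n≡m le₂)

  φ-descent : ∀ {X Y s t m} → M s t → LegalMove X Y s t → φ₁ X Y + φ₂ X Y ≤ m →
              φ₁ (X ∸ Q₁ s t) (Y ∸ Q₂ s t) + φ₂ (X ∸ Q₁ s t) (Y ∸ Q₂ s t) < m
  φ-descent {X} {Y} {s} {t} Ms mv =
    let e₁ , e₂ = legal⇒φ-shift mv
    in descent (φ₁ (X ∸ Q₁ s t) (Y ∸ Q₂ s t)) (φ₂ (X ∸ Q₁ s t) (Y ∸ Q₂ s t)) s t
               (move-pos s t Ms) (sym e₁) (sym e₂)

  -- Simultaneous recursion on the fuel of both games: every move shrinks both measures.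
  mutual
    PQf⇒Pf : ∀ n m X Y → InBQ p₁ q₁ p₂ q₂ X Y → X + Y ≤ n → φ₁ X Y + φ₂ X Y ≤ m →
             PQf p₁ q₁ p₂ q₂ M n X Y → Pf M m (φ₁ X Y) (φ₂ X Y)
    PQf⇒Pf n       zero    X Y _    _        _      _ = tt
    PQf⇒Pf zero    (suc m) X Y inBQ X+Y≤0    _      _ s t Ms s≤φ₁ t≤φ₂ _ =
      ⊥-elim (n≮0 (Q-descent Ms (φ-bounded⇒legal {X} {Y} inBQ s≤φ₁ t≤φ₂) X+Y≤0))
    PQf⇒Pf (suc n) (suc m) X Y inBQ X+Y≤1+n φ≤1+m P s t Ms s≤φ₁ t≤φ₂ P-after =
      P s t Ms Q₁≤X Q₂≤Y after∈BQ
        (Pf⇒PQf n m (X ∸ Q₁ s t) (Y ∸ Q₂ s t) after∈BQ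
                (s≤s⁻¹ (Q-descent Ms mv X+Y≤1+n)) (s≤s⁻¹ (φ-descent Ms mv φ≤1+m))
                (subst₂ (Pf M m) (proj₁ (legal⇒φ-after mv)) (proj₂ (legal⇒φ-after mv)) P-after))
      where
      mv = φ-bounded⇒legal {X} {Y} inBQ s≤φ₁ t≤φ₂
      open LegalMove mv

    Pf⇒PQf : ∀ n m X Y → InBQ p₁ q₁ p₂ q₂ X Y → X + Y ≤ n → φ₁ X Y + φ₂ X Y ≤ m →
             Pf M m (φ₁ X Y) (φ₂ X Y) → PQf p₁ q₁ p₂ q₂ M n X Y
    Pf⇒PQf zero    m       X Y _    _        _   _ = tt
    Pf⇒PQf (suc n) zero    X Y _    _        φ≤0 _ s t Ms le₁ le₂ after _ =
      ⊥-elim (n≮0 (φ-descent Ms (legalMove le₁ le₂ after) φ≤0))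
    Pf⇒PQf (suc n) (suc m) X Y inBQ X+Y≤1+n φ≤1+m P s t Ms le₁ le₂ after PQ-after =
      P s t Ms (proj₁ (legal⇒φ-bounded mv)) (proj₂ (legal⇒φ-bounded mv))
        (subst₂ (Pf M m) (sym (proj₁ (legal⇒φ-after mv))) (sym (proj₂ (legal⇒φ-after mv)))
                (PQf⇒Pf n m (X ∸ Q₁ s t) (Y ∸ Q₂ s t) after
                        (s≤s⁻¹ (Q-descent Ms mv X+Y≤1+n)) (s≤s⁻¹ (φ-descent Ms mv φ≤1+m)) PQ-after))
      where
      mv = legalMove le₁ le₂ after

  IsPQ⇔IsP∘φ : ∀ X Y → InBQ p₁ q₁ p₂ q₂ X Y → IsPQ p₁ q₁ p₂ q₂ M X Y ⇔ IsP M (φ₁ X Y) (φ₂ X Y)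
  IsPQ⇔IsP∘φ X Y inBQ =
    mk⇔ (PQf⇒Pf _ _ X Y inBQ ≤-refl ≤-refl) (Pf⇒PQf _ _ X Y inBQ ≤-refl ≤-refl)

  IsP⇔IsPQ-translates : ∀ A B →
    IsP M A B ⇔ (∀ x y → InTQ p₁ q₁ p₂ q₂ x y →
                   IsPQ p₁ q₁ p₂ q₂ M (x + A * p₁ + B * p₂) (y + A * q₁ + B * q₂))
  IsP⇔IsPQ-translates A B = mk⇔ to from
    where
    to : IsP M A B → ∀ x y → InTQ p₁ q₁ p₂ q₂ x y →
         IsPQ p₁ q₁ p₂ q₂ M (x + A * p₁ + B * p₂) (y + A * q₁ + B * q₂)
    to P x y inTQ =
      let inBQ , e₁ , e₂ = InTQ-translate A B inTQ
      in Equivalence.from (IsPQ⇔IsP∘φ (x + A * p₁ + B * p₂) (y + A * q₁ + B * q₂) inBQ)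
                          (subst₂ (IsP M) (sym e₁) (sym e₂) P)
    from : (∀ x y → InTQ p₁ q₁ p₂ q₂ x y →
              IsPQ p₁ q₁ p₂ q₂ M (x + A * p₁ + B * p₂) (y + A * q₁ + B * q₂)) → IsP M A B
    from PQ =
      let inBQ , e₁ , e₂ = InTQ-translate A B InTQ-origin
      in subst₂ (IsP M) e₁ e₂
           (Equivalence.to (IsPQ⇔IsP∘φ (0 + A * p₁ + B * p₂) (0 + A * q₁ + B * q₂) inBQ)
                           (PQ 0 0 InTQ-origin))

theorem1 : (p₁ q₁ p₂ q₂ : ℕ) → 0 < p₁ → 0 < q₂ → (d : q₁ * p₂ < p₁ * q₂) →
    (M : MoveSet) → (∀ s t → M s t → ¬ (s ≡ 0 × t ≡ 0)) →
    ((X Y : ℕ) → InBQ p₁ q₁ p₂ q₂ X Y →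
      (IsPQ p₁ q₁ p₂ q₂ M X Y ⇔ IsP M (proj₁ (φQ p₁ q₁ p₂ q₂ d X Y)) (proj₂ (φQ p₁ q₁ p₂ q₂ d X Y))))
    × ((A B : ℕ) →
      (IsP M A B ⇔ ((x y : ℕ) → InTQ p₁ q₁ p₂ q₂ x y →
        IsPQ p₁ q₁ p₂ q₂ M (x + A * p₁ + B * p₂) (y + A * q₁ + B * q₂))))
theorem1 p₁ q₁ p₂ q₂ p₁>0 q₂>0 d M M⊆B' = IsPQ⇔IsP∘φ , IsP⇔IsPQ-translates
  where open Correspondence p₁ q₁ p₂ q₂ p₁>0 q₂>0 d M M⊆B'
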